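{- Let $\pi$ be a simple permutation in $\operatorname{Av}(24153, 31524)$. Then either the greatest entry of $\pi$ lies to the left of the least entry of $\pi$, or the leftmost entry of $\pi$ lies above (i.e., has larger value than) the rightmost entry of $\pi$.
   Context: A permutation $\pi$ of length $n$ is identified with its plot $\{(i,\pi(i)) : 1\le i\le n\}$. $\sigma\le\pi$ means some subsequence of $\pi$ is order isomorphic to $\sigma$; $\operatorname{Av}(B)$ is the set of permutations containing no element of $B$. An interval of $\pi$ is a set of contiguous indices $I=[a,b]$ such that $\{\pi(i):i\in I\}$ is a set of contiguous values. $\pi$ is simple if its only intervals have size $0$, $1$ or $n$. -}

module Defs where

open import Data.Nat using (ℕ; zero; suc; _≤_; _<_)
open import Data.Fin using (Fin; toℕ)
open import Data.Fin.Permutation using (Permutation′; _⟨$⟩ʳ_)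
open import Data.Vec using (Vec; lookup; _∷_; [])
open import Data.Product using (Σ; _×_; ∃)
open import Data.Sum using (_⊎_)
open import Data.Empty using (⊥)
open import Relation.Binary.PropositionalEquality using (_≡_)
open import Function.Bundles using (_⇔_)

-- A permutation of length n is a bijection Fin n → Fin n;
-- position i (0-based) has value π ⟨$⟩ʳ i (0-based).
-- Entry value at position i, as a natural number:
val : ∀ {n} → Permutation′ n → Fin n → ℕ
val π i = toℕ (π ⟨$⟩ʳ i)

-- A pattern of length k given as a list of (distinct) values; only the
-- relative order of the values matters.
Pattern : ℕ → Set
Pattern k = Vec ℕ k

_≼_ : ∀ {k n} → Pattern k → Permutation′ n → Set
_≼_ {k} {n} σ π =
  Σ (Fin k → Fin n) λ f →
    (∀ i j → toℕ i < toℕ j → toℕ (f i) < toℕ (f j)) ×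
    (∀ i j → (lookup σ i < lookup σ j) ⇔ (val π (f i) < val π (f j)))

Avoids : ∀ {k n} → Permutation′ n → Pattern k → Set
Avoids π σ = σ ≼ π → ⊥

p24153 : Pattern 5
p24153 = 2 ∷ 4 ∷ 1 ∷ 5 ∷ 3 ∷ []

p31524 : Pattern 5
p31524 = 3 ∷ 1 ∷ 5 ∷ 2 ∷ 4 ∷ []

IsInterval : ∀ {n} → Permutation′ n → ℕ → ℕ → Set
IsInterval {n} π a b =
  ∀ (i j : Fin n) (v : ℕ) →
    a ≤ toℕ i → toℕ i ≤ b → a ≤ toℕ j → toℕ j ≤ b →
    val π i ≤ v → v ≤ val π j →
    ∃ λ (k : Fin n) → a ≤ toℕ k × toℕ k ≤ b × val π k ≡ v

-- π is simple: every nonempty interval [a,b] (with b < n) has size 1 or n.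
-- (Empty intervals have size 0 and are always allowed.)
IsSimple : ∀ {n} → Permutation′ n → Set
IsSimple {n} π =
  ∀ (a b : ℕ) → a ≤ b → b < n → IsInterval π a b →
    (a ≡ b) ⊎ (a ≡ 0 × suc b ≡ n)

module Submission where

-- Suppose neither holds: the minimum (position p) lies left of the maximum
-- (position q) and the first entry a lies below the last entry b.
-- * If p = 0, positions 1..m form a proper interval; so p > 0.
-- * Let M be the largest entry left of p.  M < b, for otherwise the entries
--   at 0, pos(M), p, q, m form 24153.
-- * Let j be the rightmost position with an entry below M, and U the largest
--   entry at a position ≤ j.  Every entry right of j exceeds U, for otherwise
--   pos(M), p, pos(U), j and that entry form 31524.
-- * Hence positions 0..j form an interval; 0 < p ≤ j and the entry at j is
--   below M < b (so j ≠ m), contradicting simplicity.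

open import Defs
open import Data.Nat using (ℕ; suc; _≤_; _<_; _>_)
open import Data.Fin using (Fin; zero; fromℕ; toℕ)
open import Data.Fin.Permutation using (Permutation′; _⟨$⟩ʳ_; _⟨$⟩ˡ_)
open import Data.Sum using (_⊎_)

open import Data.Nat using (z≤n; s≤s; _≟_; _≤?_; _<?_)
open import Data.Nat.Properties
open import Data.Fin using (suc; fromℕ<)
open import Data.Fin.Properties
  using (toℕ-injective; toℕ<n; toℕ≤pred[n]; toℕ-fromℕ; toℕ-fromℕ<; any?; all?)
open import Data.Fin.Permutation using (inverseˡ; inverseʳ)
open import Data.Vec using (lookup)
open import Data.Product using (Σ; _×_; ∃; _,_; proj₁; proj₂)
open import Data.Sum using (inj₁; inj₂)
open import Data.Empty using (⊥; ⊥-elim)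
open import Function using (_∘_)
open import Relation.Nullary using (Dec; yes; no; ¬_)
open import Relation.Nullary.Decidable using (_×-dec_; toWitness)
open import Relation.Binary.PropositionalEquality
open import Relation.Binary.Definitions using (tri<; tri≈; tri>)
open import Function.Bundles using (mk⇔)

StepIncreasing : (ℕ → ℕ) → ℕ → ℕ → Set
StepIncreasing g lo hi = ∀ r → lo ≤ r → r < hi → g r < g (suc r)

step-increasing⇒increasing : ∀ {g lo hi} → StepIncreasing g lo hi →
  ∀ {x y} → lo ≤ x → x < y → y ≤ hi → g x < g y
step-increasing⇒increasing st {x} {suc y} lo≤x (s≤s x≤y) y<hi
  with m≤n⇒m<n∨m≡n x≤y
... | inj₂ refl = st x lo≤x y<hi
... | inj₁ x<y =
  <-trans (step-increasing⇒increasing st lo≤x x<y (<⇒≤ y<hi))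
          (st y (≤-trans lo≤x (<⇒≤ x<y)) y<hi)

-- An occurrence of a pattern σ of length k: positions pt 1 < … < pt k
-- (1-based, as in the paper) and a listing C 1 < … < C k of entries by rank
-- such that the i-th position carries the entry of rank σ(i).  Listing the
-- values by rank makes the converse comparison immediate.
occurrence : ∀ {k n} (π : Permutation′ n) (σ : Pattern k) (pt : ℕ → Fin n)
  (C : ℕ → ℕ) → StepIncreasing (toℕ ∘ pt) 1 k → StepIncreasing C 1 k →
  (∀ i → 1 ≤ lookup σ i × lookup σ i ≤ k) →
  (∀ i → val π (pt (suc (toℕ i))) ≡ C (lookup σ i)) → σ ≼ π
occurrence {k} π σ pt C pt-inc C-inc σ-range σ-ranks =
  pt ∘ suc ∘ toℕ , positions-increase , λ i j → mk⇔ (ranks-compare i j) (compare-ranks i j)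
  where
  positions-increase : ∀ i j → toℕ i < toℕ j → toℕ (pt (suc (toℕ i))) < toℕ (pt (suc (toℕ j)))
  positions-increase i j i<j = step-increasing⇒increasing pt-inc (s≤s z≤n) (s≤s i<j) (toℕ<n j)
  ranks-compare : ∀ i j → lookup σ i < lookup σ j →
    val π (pt (suc (toℕ i))) < val π (pt (suc (toℕ j)))
  ranks-compare i j σi<σj = subst₂ _<_ (sym (σ-ranks i)) (sym (σ-ranks j))
    (step-increasing⇒increasing C-inc (proj₁ (σ-range i)) σi<σj (proj₂ (σ-range j)))
  compare-ranks : ∀ i j → val π (pt (suc (toℕ i))) < val π (pt (suc (toℕ j))) →
    lookup σ i < lookup σ j
  compare-ranks i j vi<vj with <-cmp (lookup σ i) (lookup σ j)
  ... | tri< σi<σj _ _ = σi<σj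
  ... | tri≈ _ σi≡σj _ =
    ⊥-elim (<-irrefl (trans (σ-ranks i) (trans (cong C σi≡σj) (sym (σ-ranks j)))) vi<vj)
  ... | tri> _ _ σj<σi = ⊥-elim (<-asym vi<vj (ranks-compare j i σj<σi))

tuple : ∀ {A : Set} → A → A → A → A → A → ℕ → A
tuple a₁ a₂ a₃ a₄ a₅ 2 = a₂
tuple a₁ a₂ a₃ a₄ a₅ 3 = a₃
tuple a₁ a₂ a₃ a₄ a₅ 4 = a₄
tuple a₁ a₂ a₃ a₄ a₅ 5 = a₅
tuple a₁ a₂ a₃ a₄ a₅ _ = a₁

steps-1to5 : ∀ {g : ℕ → ℕ} →
  g 1 < g 2 → g 2 < g 3 → g 3 < g 4 → g 4 < g 5 → StepIncreasing g 1 5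
steps-1to5 s₁ s₂ s₃ s₄ 1 _ _ = s₁
steps-1to5 s₁ s₂ s₃ s₄ 2 _ _ = s₂
steps-1to5 s₁ s₂ s₃ s₄ 3 _ _ = s₃
steps-1to5 s₁ s₂ s₃ s₄ 4 _ _ = s₄
steps-1to5 _ _ _ _ 0 () _
steps-1to5 _ _ _ _ (suc (suc (suc (suc (suc r))))) _ (s≤s (s≤s (s≤s (s≤s (s≤s ())))))

-- Positions x₁ < … < x₅ whose entries increase in the order x₃, x₁, x₅, x₂, x₄
-- (the inverse of 24153) form an occurrence of 24153.
occurs-24153 : ∀ {n} (π : Permutation′ n) (x₁ x₂ x₃ x₄ x₅ : Fin n) →
  StepIncreasing (toℕ ∘ tuple x₁ x₂ x₃ x₄ x₅) 1 5 →
  StepIncreasing (val π ∘ tuple x₃ x₁ x₅ x₂ x₄) 1 5 → p24153 ≼ π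
occurs-24153 π x₁ x₂ x₃ x₄ x₅ positions values =
  occurrence π p24153 (tuple x₁ x₂ x₃ x₄ x₅) (val π ∘ tuple x₃ x₁ x₅ x₂ x₄)
    positions values
    (toWitness {a? = all? λ i → (1 ≤? lookup p24153 i) ×-dec (lookup p24153 i ≤? 5)} _)
    λ { zero → refl ; (suc zero) → refl ; (suc (suc zero)) → refl
      ; (suc (suc (suc zero))) → refl ; (suc (suc (suc (suc zero)))) → refl }

-- Positions x₁ < … < x₅ whose entries increase in the order x₂, x₄, x₁, x₅, x₃
-- (the inverse of 31524) form an occurrence of 31524.
occurs-31524 : ∀ {n} (π : Permutation′ n) (x₁ x₂ x₃ x₄ x₅ : Fin n) →
  StepIncreasing (toℕ ∘ tuple x₁ x₂ x₃ x₄ x₅) 1 5 →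
  StepIncreasing (val π ∘ tuple x₂ x₄ x₁ x₅ x₃) 1 5 → p31524 ≼ π
occurs-31524 π x₁ x₂ x₃ x₄ x₅ positions values =
  occurrence π p31524 (tuple x₁ x₂ x₃ x₄ x₅) (val π ∘ tuple x₂ x₄ x₁ x₅ x₃)
    positions values
    (toWitness {a? = all? λ i → (1 ≤? lookup p31524 i) ×-dec (lookup p31524 i ≤? 5)} _)
    λ { zero → refl ; (suc zero) → refl ; (suc (suc zero)) → refl
      ; (suc (suc (suc zero))) → refl ; (suc (suc (suc (suc zero)))) → refl }

argmax : ∀ {n} (P : Fin n → Set) → (∀ i → Dec (P i)) → (g : Fin n → ℕ) → ∃ P →
  Σ (Fin n) λ i → P i × (∀ j → P j → g j ≤ g i)
argmax {suc n} P P? g (w , Pw) with any? (λ i → P? (suc i))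
... | no ¬P-suc = zero , P-zero w Pw , λ { zero _ → ≤-refl ; (suc j) Pj → ⊥-elim (¬P-suc (j , Pj)) }
  where
  P-zero : ∀ w → P w → P zero
  P-zero zero Pw = Pw
  P-zero (suc w) Pw = ⊥-elim (¬P-suc (w , Pw))
... | yes P-suc with argmax (P ∘ suc) (P? ∘ suc) (g ∘ suc) P-suc
...   | i , Pi , i-max with P? zero
...     | no ¬P0 = suc i , Pi , λ { zero P0 → ⊥-elim (¬P0 P0) ; (suc j) Pj → i-max j Pj }
...     | yes P0 with g zero ≤? g (suc i)
...       | yes g0≤ = suc i , Pi , λ { zero _ → g0≤ ; (suc j) Pj → i-max j Pj }
...       | no g0≰ = zero , P0 , λ { zero _ → ≤-refl
                                  ; (suc j) Pj → ≤-trans (i-max j Pj) (<⇒≤ (≰⇒> g0≰)) }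

module PermutationFacts {n} (π : Permutation′ n) where

  val-injective : ∀ {i j} → val π i ≡ val π j → i ≡ j
  val-injective {i} {j} vi≡vj = begin
    i                  ≡⟨ sym (inverseˡ π) ⟩
    π ⟨$⟩ˡ (π ⟨$⟩ʳ i)  ≡⟨ cong (π ⟨$⟩ˡ_) (toℕ-injective vi≡vj) ⟩
    π ⟨$⟩ˡ (π ⟨$⟩ʳ j)  ≡⟨ inverseˡ π ⟩
    j                  ∎
    where open ≡-Reasoning

  same-value⇒same-position : ∀ {i j} → val π i ≡ val π j → toℕ i ≡ toℕ j
  same-value⇒same-position = cong toℕ ∘ val-injective

  same-position⇒same-value : ∀ {i j} → toℕ i ≡ toℕ j → val π i ≡ val π j
  same-position⇒same-value = cong (val π) ∘ toℕ-injective

  val-position : ∀ v → val π (π ⟨$⟩ˡ v) ≡ toℕ v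
  val-position v = cong toℕ (inverseʳ π)

  val<n : ∀ i → val π i < n
  val<n i = toℕ<n (π ⟨$⟩ʳ i)

  position-of : ∀ v → v < n → ∃ λ k → val π k ≡ v
  position-of v v<n = π ⟨$⟩ˡ fromℕ< v<n , trans (val-position _) (toℕ-fromℕ< v<n)

  -- [a,b] is an interval as soon as every entry lying between two entries of
  -- [a,b] is itself at a position in [a,b] (all values below n are entries).
  interval-by-closure : ∀ a b →
    (∀ i j k → a ≤ toℕ i → toℕ i ≤ b → a ≤ toℕ j → toℕ j ≤ b →
      val π i ≤ val π k → val π k ≤ val π j → a ≤ toℕ k × toℕ k ≤ b) →
    IsInterval π a b
  interval-by-closure a b closed i j v a≤i i≤b a≤j j≤b vi≤v v≤vj
    with position-of v (≤-<-trans v≤vj (val<n j))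
  ... | k , refl with closed i j k a≤i i≤b a≤j j≤b vi≤v v≤vj
  ...   | a≤k , k≤b = k , a≤k , k≤b , refl

module SimplePermutation (m : ℕ) (m≥2 : 2 ≤ m) (π : Permutation′ (suc m))
  (simple : IsSimple π) where
  open PermutationFacts π

  last : Fin (suc m)
  last = fromℕ m

  toℕ-last : toℕ last ≡ m
  toℕ-last = toℕ-fromℕ m

  pMin pMax : Fin (suc m)
  pMin = π ⟨$⟩ˡ zero
  pMax = π ⟨$⟩ˡ last

  val-pMin : val π pMin ≡ 0
  val-pMin = val-position zero

  val-pMax : val π pMax ≡ m
  val-pMax = trans (val-position last) toℕ-last

  0<m : 0 < m
  0<m = <-trans (s≤s z≤n) m≥2

  val≤m : ∀ i → val π i ≤ m
  val≤m i = toℕ≤pred[n] (π ⟨$⟩ʳ i)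

  positive-off-min : ∀ k → toℕ k ≢ toℕ pMin → 0 < val π k
  positive-off-min k k≢p = n≢0⇒n>0 λ vk≡0 →
    k≢p (same-value⇒same-position (trans vk≡0 (sym val-pMin)))

  -- In a simple permutation of length ≥ 3 the minimum is not the first
  -- entry: otherwise positions 1..m would form a proper interval.
  min-not-first : toℕ pMin ≢ 0
  min-not-first p≡0 with simple 1 m (<⇒≤ m≥2) ≤-refl tail-interval
    where
    after-first : ∀ k → 0 < val π k → 1 ≤ toℕ k
    after-first k 0<vk = n≢0⇒n>0 λ k≡0 → n≮0 (subst (0 <_)
      (trans (same-position⇒same-value (trans k≡0 (sym p≡0))) val-pMin) 0<vk)
    tail-interval : IsInterval π 1 m
    tail-interval = interval-by-closure 1 m λ i _ k 1≤i _ _ _ vi≤vk _ →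
      after-first k (<-≤-trans (positive-off-min i λ i≡p → <⇒≢ 1≤i (sym (trans i≡p p≡0))) vi≤vk)
      , toℕ≤pred[n] k
  ... | inj₁ 1≡m = <-irrefl 1≡m m≥2
  ... | inj₂ (() , _)

  min-before-max : ¬ (toℕ pMax < toℕ pMin) → toℕ pMin < toℕ pMax
  min-before-max q≮p = ≤∧≢⇒< (≮⇒≥ q≮p) λ p≡q →
    <⇒≢ 0<m (trans (sym val-pMin) (trans (same-position⇒same-value p≡q) val-pMax))

  first-below-last : ¬ (val π last < val π zero) → val π zero < val π last
  first-below-last b≮a = ≤∧≢⇒< (≮⇒≥ b≮a) λ a≡b →
    <⇒≢ 0<m (trans (same-value⇒same-position a≡b) toℕ-last)

  module MinBeforeMax (no-24153 : Avoids π p24153) (no-31524 : Avoids π p31524)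
    (0<p : 0 < toℕ pMin) (p<q : toℕ pMin < toℕ pMax)
    (first<last : val π zero < val π last) where

    p : ℕ
    p = toℕ pMin

    -- The
    -- maximisers below are opaque: only their specifications are used, and
    -- unfolding the search during type checking is prohibitively expensive.
    opaque
      left-max : Σ (Fin (suc m)) λ i → toℕ i < p × (∀ j → toℕ j < p → val π j ≤ val π i)
      left-max = argmax (λ j → toℕ j < p) (λ j → toℕ j <? p) (val π) (zero , 0<p)

    iM : Fin (suc m)
    iM = proj₁ left-max

    iM<p : toℕ iM < p
    iM<p = proj₁ (proj₂ left-max)

    M : ℕ
    M = val π iM

    0<M : 0 < M
    0<M = positive-off-min iM (<⇒≢ iM<p)

    M<m : M < m
    M<m = ≤∧≢⇒< (val≤m iM) λ M≡m →
      <⇒≢ (<-trans iM<p p<q) (same-value⇒same-position (trans M≡m (sym val-pMax)))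

    -- M lies below the last entry b: if b < M then the entries at
    -- 0, iM, pMin, pMax, last are ordered as 24153.
    M<last : M < val π last
    M<last with toℕ iM ≟ 0 | <-cmp M (val π last)
    ... | yes iM≡0 | _ = subst (_< val π last) (same-position⇒same-value (sym iM≡0)) first<last
    ... | no _ | tri< M<b _ _ = M<b
    ... | no _ | tri≈ _ M≡b _ = ⊥-elim (<⇒≢ (<-≤-trans (<-trans iM<p p<q) (toℕ≤pred[n] pMax))
                                            (trans (same-value⇒same-position M≡b) toℕ-last))
    ... | no iM≢0 | tri> _ _ b<M = ⊥-elim (no-24153 (occurs-24153 π zero iM pMin pMax last
          (steps-1to5 (n≢0⇒n>0 iM≢0) iM<p p<q q<last)
          (steps-1to5 (subst (_< val π zero) (sym val-pMin) (positive-off-min zero (<⇒≢ 0<p)))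
                      first<last b<M (subst (M <_) (sym val-pMax) M<m))))
      where
      q<last : toℕ pMax < toℕ last
      q<last = subst (toℕ pMax <_) (sym toℕ-last) (≤∧≢⇒< (toℕ≤pred[n] pMax) λ q≡m →
        <-asym M<m (subst (_< M) (trans (same-position⇒same-value (trans toℕ-last (sym q≡m))) val-pMax) b<M))

    opaque
      rightmost-below-M : Σ (Fin (suc m)) λ i → val π i < M × (∀ x → val π x < M → toℕ x ≤ toℕ i)
      rightmost-below-M = argmax (λ x → val π x < M) (λ x → val π x <? M) toℕ
        (pMin , subst (_< M) (sym val-pMin) 0<M)

    j : Fin (suc m)
    j = proj₁ rightmost-below-M

    vj<M : val π j < M
    vj<M = proj₁ (proj₂ rightmost-below-M)

    p≤j : p ≤ toℕ j
    p≤j = proj₂ (proj₂ rightmost-below-M) pMin (subst (_< M) (sym val-pMin) 0<M)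

    opaque
      prefix-max : Σ (Fin (suc m)) λ i → toℕ i ≤ toℕ j × (∀ x → toℕ x ≤ toℕ j → val π x ≤ val π i)
      prefix-max = argmax (λ x → toℕ x ≤ toℕ j) (λ x → toℕ x ≤? toℕ j) (val π) (j , ≤-refl)

    u : Fin (suc m)
    u = proj₁ prefix-max

    u≤j : toℕ u ≤ toℕ j
    u≤j = proj₁ (proj₂ prefix-max)

    U : ℕ
    U = val π u

    -- Every entry right of j exceeds U: an entry below U there would make
    -- iM, pMin, u, j and its position an occurrence of 31524.
    after-j-above-U : ∀ x → toℕ j < toℕ x → U < val π x
    after-j-above-U x j<x with <-cmp U (val π x)
    ... | tri< U<x _ _ = U<x
    ... | tri≈ _ U≡x _ = ⊥-elim (<⇒≱ j<x (subst (_≤ toℕ j) (same-value⇒same-position U≡x) u≤j))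
    ... | tri> _ _ x<U = ⊥-elim (no-31524 (occurs-31524 π iM pMin u j x
          (steps-1to5 iM<p p<u u<j j<x)
          (steps-1to5 (subst (_< val π j) (sym val-pMin) 0<vj) vj<M M<x x<U)))
      where
      M<x : M < val π x
      M<x = ≤∧≢⇒< (≮⇒≥ λ x<M → <⇒≱ j<x (proj₂ (proj₂ rightmost-below-M) x x<M))
        λ M≡x → <⇒≢ (<-trans iM<p (≤-<-trans p≤j j<x)) (same-value⇒same-position M≡x)
      M<U : M < U
      M<U = <-trans M<x x<U
      p<u : p < toℕ u
      p<u = ≤∧≢⇒< (≮⇒≥ λ u<p → <⇒≱ M<U (proj₂ (proj₂ left-max) u u<p))
        λ p≡u → n≮0 (subst (M <_) (trans (same-position⇒same-value (sym p≡u)) val-pMin) M<U)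
      u<j : toℕ u < toℕ j
      u<j = ≤∧≢⇒< u≤j λ u≡j → <-asym M<U (subst (_< M) (sym (same-position⇒same-value u≡j)) vj<M)
      0<vj : 0 < val π j
      0<vj = positive-off-min j λ j≡p → <⇒≢ (<-trans p<u u<j) (sym j≡p)

    -- Hence positions 0..j carry exactly the entries ≤ U: an interval.
    prefix-interval : IsInterval π 0 (toℕ j)
    prefix-interval = interval-by-closure 0 (toℕ j) λ _ i k _ _ _ i≤j _ vk≤vi →
      z≤n , ≮⇒≥ λ j<k →
        <⇒≱ (after-j-above-U k j<k) (≤-trans vk≤vi (proj₂ (proj₂ prefix-max) i i≤j))

    -- The interval 0..j is proper: j ≥ p > 0, and j is not the last position
    -- since its entry is below M < b.
    impossible : ⊥
    impossible with simple 0 (toℕ j) z≤n (toℕ<n j) prefix-interval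
    ... | inj₁ 0≡j = <⇒≢ (<-≤-trans 0<p p≤j) 0≡j
    ... | inj₂ (_ , j+1≡n) = <-asym vj<M (subst (M <_) last≡j M<last)
      where
      last≡j : val π last ≡ val π j
      last≡j = same-position⇒same-value (trans toℕ-last (sym (suc-injective j+1≡n)))

proposition4p1 : (m : ℕ) → 2 ≤ m → (π : Permutation′ (suc m)) →
    IsSimple π → Avoids π p24153 → Avoids π p31524 →
    (toℕ (π ⟨$⟩ˡ fromℕ m) < toℕ (π ⟨$⟩ˡ zero))
    ⊎ (val π zero > val π (fromℕ m))
proposition4p1 m m≥2 π simple no-24153 no-31524
  with toℕ (π ⟨$⟩ˡ fromℕ m) <? toℕ (π ⟨$⟩ˡ zero) | val π (fromℕ m) <? val π zero
... | yes max-before-min | _ = inj₁ max-before-min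
... | no _ | yes last<first = inj₂ last<first
... | no q≮p | no b≮a = ⊥-elim (MinBeforeMax.impossible no-24153 no-31524
      (n≢0⇒n>0 min-not-first) (min-before-max q≮p) (first-below-last b≮a))
  where open SimplePermutation m m≥2 π simple
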